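{- Let $\Gamma$ be a finite connected directed graph without self-loops, with $V=|V(\Gamma)|\ge2$ vertices indexed by a bijection $v:\{1,\dots,V\}\to V(\Gamma)$, and let $t_e>0$ for each $e\in E(\Gamma)$. Define the incidence numbers $\rho_{w,e}=1$ if $h(e)=w$, $\rho_{w,e}=-1$ if $t(e)=w$, and $\rho_{w,e}=0$ otherwise, and the $(V-1)\times(V-1)$ matrix $$M_\Gamma(t)_{i,j}=\sum_{e\in E(\Gamma)}\rho_{v(i),e}\frac{1}{t_e}\rho_{v(j),e},\qquad 1\le i,j\le V-1.$$ Then $M_\Gamma(t)$ is invertible and $$\Big|\frac{\sum_{i=1}^{V-1}\rho_{v(i),e}\,M_\Gamma^{ -1}(t)_{i,j}}{t_e}\Big|\le 2\qquad\text{for all }e\in E(\Gamma),\ 1\le j\le V-1.$$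
   Context: A directed graph has vertex set $V(\Gamma)$, edge set $E(\Gamma)$ and head/tail maps $h,t:E(\Gamma)\to V(\Gamma)$; multiple edges are allowed, and no self-loops means $h(e)\ne t(e)$ for every edge. $M_\Gamma^{ -1}(t)_{i,j}$ denotes the $(i,j)$ entry of the inverse matrix. -}

module Defs where

open import Level using (Level; _⊔_) renaming (suc to lsuc)
open import Data.Nat using (ℕ; zero; suc)
import Data.Nat as ℕ
open import Data.Fin using (Fin; zero; suc; inject₁; _≟_)
import Data.Fin as Fin
open import Data.Product using (_×_; Σ)
open import Relation.Nullary using (¬_; yes; no)
open import Relation.Binary.PropositionalEquality using (_≡_; _≢_)
open import Relation.Binary.Core using (Rel)
open import Relation.Binary.Structures using (IsTotalOrder)
open import Algebra.Bundles using (CommutativeRing)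
open import Function.Bundles using (_↔_; Inverse)

-- Ordered fields (the stdlib has no real numbers; we state the theorem
-- over an arbitrary ordered field, of which ℝ is an instance).

record OrderedField (c ℓ : Level) : Set (lsuc (c ⊔ ℓ)) where
  field
    commutativeRing : CommutativeRing c ℓ
  open CommutativeRing commutativeRing public hiding (zero)
  infix 4 _≤_
  infix 9 _⁻¹
  field
    _≤_          : Rel Carrier ℓ
    isTotalOrder : IsTotalOrder _≈_ _≤_
    +-monoˡ-≤    : ∀ {x y} z → x ≤ y → x + z ≤ y + z
    *-nonneg     : ∀ {x y} → 0# ≤ x → 0# ≤ y → 0# ≤ x * y
    0≉1          : ¬ (0# ≈ 1#)
    _⁻¹          : Carrier → Carrier
    ⁻¹-inverseʳ  : ∀ {x} → ¬ (x ≈ 0#) → x * x ⁻¹ ≈ 1#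

  _<_ : Rel Carrier ℓ
  x < y = (x ≤ y) × ¬ (x ≈ y)

  2# : Carrier
  2# = 1# + 1#

  AbsLe : Carrier → Carrier → Set ℓ
  AbsLe x y = (- y ≤ x) × (x ≤ y)

  ∑ : (n : ℕ) → (Fin n → Carrier) → Carrier
  ∑ ℕ.zero    f = 0#
  ∑ (suc n) f = f Fin.zero + ∑ n (λ i → f (suc i))

record DiGraph (V E : ℕ) : Set where
  field
    head : Fin E → Fin V
    tail : Fin E → Fin V

module _ {V E : ℕ} (Γ : DiGraph V E) where
  open DiGraph Γ

  NoSelfLoops : Set
  NoSelfLoops = ∀ e → head e ≢ tail e

  data Walk : Fin V → Fin V → Set where
    [] : ∀ {u} → Walk u u
    fwd : ∀ e {w} → Walk (head e) w → Walk (tail e) w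
    bwd : ∀ e {w} → Walk (tail e) w → Walk (head e) w

  Connected : Set
  Connected = ∀ u w → Walk u w

module _ {c ℓ} (F : OrderedField c ℓ) where
  open OrderedField F

  ρ : ∀ {V E} → DiGraph V E → Fin V → Fin E → Carrier
  ρ Γ w e with DiGraph.head Γ e ≟ w
  ... | yes _ = 1#
  ... | no _ with DiGraph.tail Γ e ≟ w
  ...   | yes _ = - 1#
  ...   | no _  = 0#

  M : ∀ {n E} → DiGraph (suc n) E → (Fin (suc n) ↔ Fin (suc n)) →
      (Fin E → Carrier) → Fin n → Fin n → Carrier
  M {n} {E} Γ v t i j =
    ∑ E (λ e → ρ Γ (Inverse.to v (inject₁ i)) e * (t e ⁻¹ * ρ Γ (Inverse.to v (inject₁ j)) e))

  _⊗_ : ∀ {n} → (Fin n → Fin n → Carrier) → (Fin n → Fin n → Carrier) → Fin n → Fin n → Carrier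
  _⊗_ {n} A B i j = ∑ n (λ k → A i k * B k j)

  Id : ∀ {n} → Fin n → Fin n → Carrier
  Id i j with i ≟ j
  ... | yes _ = 1#
  ... | no _  = 0#

  IsInverseMatrix : ∀ {n} → (Fin n → Fin n → Carrier) → (Fin n → Fin n → Carrier) → Set ℓ
  IsInverseMatrix A N = (∀ i j → (A ⊗ N) i j ≈ Id i j) × (∀ i j → (N ⊗ A) i j ≈ Id i j)

module Submission where

-- Read the vertices as the nodes of a resistor network in
-- which edge e has conductance cₑ = 1/tₑ and the last vertex v(V) is
-- grounded.  Then M = M_Γ(t) is the grounded Laplacian, and xᵀ M x =
-- ∑ₑ cₑ (drop of x along e)² is the energy dissipated by potentials x.
--
--  1. Algebra (SymmetricInverse): over an ordered field every symmetric
--     matrix whose quadratic form is anisotropic has a symmetric inverse;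
--     it is built by induction through the Schur complement of a pivot.
--  2. Network: M is symmetric, and on a connected graph zero energy forces
--     all drops, hence all grounded potentials, to vanish; so M⁻¹ exists.
--  3. Unit currents (Network.UnitCurrent): column j of M⁻¹ are the
--     potentials X of a unit current injected at v(j) and extracted at the
--     ground, and ∑ᵢ ρ_{v(i),e} M⁻¹ᵢⱼ / tₑ is the current through e.  Cutting
--     the vertices at the potential of an endpoint of e, every edge current
--     crosses the cut in the same direction and together they carry the
--     net current, at most 1; hence the current through e lies in [−1, 1].

open import Defs
open import Level using (_⊔_)
open import Data.Nat using (ℕ; zero; suc) renaming (_≤_ to _≤ℕ_)
import Data.Nat as ℕ
import Data.Nat.Properties as ℕ
open import Data.Integer as ℤ using (ℤ; +_; -[1+_]; _⊖_; sign; ∣_∣; _◃_)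
import Data.Integer.Properties as ℤ
open import Data.Sign as Sign using (Sign)
open import Data.Fin using (Fin; zero; suc; inject₁; fromℕ; _≟_)
open import Data.Fin.Properties using (suc-injective)
open import Data.Product using (Σ; _×_; _,_; proj₁; proj₂)
open import Data.Sum using (_⊎_; inj₁; inj₂)
open import Data.Maybe using (Maybe; just; nothing)
open import Function using (_∘_)
open import Function.Bundles using (_↔_; Inverse)
open import Relation.Nullary using (¬_; yes; no; Dec; contradiction)
import Relation.Binary.PropositionalEquality as ≡
open ≡ using (_≡_; _≢_)
open import Relation.Binary.Bundles using (Poset)
open import Relation.Binary.Structures using (IsTotalOrder)
import Relation.Binary.Reasoning.PartialOrder
import Relation.Binary.Reasoning.Setoid
open import Algebra.Bundles using (CommutativeRing)
open import Algebra.Solver.Ring.AlmostCommutativeRing using (fromCommutativeRing; _-Raw-AlmostCommutative⟶_)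

-- The standard library's ring solver normalises polynomials whose
-- coefficients come from a ring mapped homomorphically into the target;
-- every commutative ring receives the canonical map from ℤ.
module IntegerRingSolver {c ℓ} (R : CommutativeRing c ℓ) where
  open CommutativeRing R hiding (zero)
  open import Algebra.Properties.Ring ring using (-‿involutive; -0#≈0#; -‿anti-homo-+; -1*x≈-x)
  open import Algebra.Properties.Semiring.Mult.TCOptimised semiring
    using (×-homo-+; ×1-homo-*; 1+×) renaming (_×_ to _·_)
  open import Algebra.Properties.CommutativeSemigroup +-commutativeSemigroup using () renaming (interchange to +-interchange)
  open import Algebra.Properties.CommutativeSemigroup *-commutativeSemigroup using () renaming (interchange to *-interchange)
  open Relation.Binary.Reasoning.Setoid setoid

  -- the canonical image of an integer; the multiples n · 1# are those with
  -- 0 · x = 0# and 1 · x = x definitionally, so small constants normalise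
  ⟦_⟧ℤ : ℤ → Carrier
  ⟦ + n ⟧ℤ      = n · 1#
  ⟦ -[1+ n ] ⟧ℤ = - (suc n · 1#)

  -‿homo : ∀ i → ⟦ ℤ.- i ⟧ℤ ≈ - ⟦ i ⟧ℤ
  -‿homo (+ zero)  = sym -0#≈0#
  -‿homo (+ suc n) = refl
  -‿homo -[1+ n ]  = sym (-‿involutive _)

  ⊖-homo : ∀ m n → ⟦ m ⊖ n ⟧ℤ ≈ m · 1# - n · 1#
  ⊖-homo m zero = begin
    ⟦ m ⊖ zero ⟧ℤ     ≡⟨ ≡.cong ⟦_⟧ℤ (ℤ.⊖-≥ {m} ℕ.z≤n) ⟩
    m · 1#           ≈⟨ +-identityʳ _ ⟨
    m · 1# + 0#      ≈⟨ +-congˡ -0#≈0# ⟨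
    m · 1# - 0#      ∎
  ⊖-homo zero (suc n) = sym (+-identityˡ _)
  ⊖-homo (suc m) (suc n) = begin
    ⟦ suc m ⊖ suc n ⟧ℤ                 ≡⟨ ≡.cong ⟦_⟧ℤ (ℤ.[1+m]⊖[1+n]≡m⊖n m n) ⟩
    ⟦ m ⊖ n ⟧ℤ                         ≈⟨ ⊖-homo m n ⟩
    m · 1# - n · 1#                   ≈⟨ +-identityˡ _ ⟨
    0# + (m · 1# - n · 1#)            ≈⟨ +-congʳ (-‿inverseʳ 1#) ⟨
    (1# - 1#) + (m · 1# - n · 1#)     ≈⟨ +-interchange 1# (- 1#) (m · 1#) (- (n · 1#)) ⟩
    (1# + m · 1#) + (- 1# - n · 1#)   ≈⟨ +-congˡ (trans (+-comm _ _) (sym (-‿anti-homo-+ 1# (n · 1#)))) ⟩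
    (1# + m · 1#) - (1# + n · 1#)     ≈⟨ +-cong (1+× m 1#) (-‿cong (1+× n 1#)) ⟨
    suc m · 1# - suc n · 1#           ∎

  +-homo : ∀ i j → ⟦ i ℤ.+ j ⟧ℤ ≈ ⟦ i ⟧ℤ + ⟦ j ⟧ℤ
  +-homo (+ m)    (+ n)    = ×-homo-+ 1# m n
  +-homo (+ m)    -[1+ n ] = ⊖-homo m (suc n)
  +-homo -[1+ m ] (+ n)    = trans (⊖-homo n (suc m)) (+-comm _ _)
  +-homo -[1+ m ] -[1+ n ] = begin
    - (suc (suc (m ℕ.+ n)) · 1#)          ≡⟨ ≡.cong (λ k → - (suc k · 1#)) (ℕ.+-suc m n) ⟨
    - ((suc m ℕ.+ suc n) · 1#)            ≈⟨ -‿cong (×-homo-+ 1# (suc m) (suc n)) ⟩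
    - (suc m · 1# + suc n · 1#)           ≈⟨ -‿anti-homo-+ _ _ ⟩
    - (suc n · 1#) - suc m · 1#           ≈⟨ +-comm _ _ ⟩
    - (suc m · 1#) - suc n · 1#           ∎

  ⟦_⟧ₛ : Sign → Carrier
  ⟦ Sign.+ ⟧ₛ = 1#
  ⟦ Sign.- ⟧ₛ = - 1#

  sign-homo : ∀ s t → ⟦ s Sign.* t ⟧ₛ ≈ ⟦ s ⟧ₛ * ⟦ t ⟧ₛ
  sign-homo Sign.+ t      = sym (*-identityˡ _)
  sign-homo Sign.- Sign.+ = sym (*-identityʳ _)
  sign-homo Sign.- Sign.- = sym (trans (-1*x≈-x _) (-‿involutive _))

  ◃-homo : ∀ s n → ⟦ s ◃ n ⟧ℤ ≈ ⟦ s ⟧ₛ * n · 1#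
  ◃-homo s      zero    = sym (zeroʳ _)
  ◃-homo Sign.+ (suc n) = sym (*-identityˡ _)
  ◃-homo Sign.- (suc n) = sym (-1*x≈-x _)

  sign-abs : ∀ i → ⟦ i ⟧ℤ ≈ ⟦ sign i ⟧ₛ * ∣ i ∣ · 1#
  sign-abs (+ n)    = sym (*-identityˡ _)
  sign-abs -[1+ n ] = sym (-1*x≈-x _)

  *-homo : ∀ i j → ⟦ i ℤ.* j ⟧ℤ ≈ ⟦ i ⟧ℤ * ⟦ j ⟧ℤ
  *-homo i j = begin
    ⟦ (sign i Sign.* sign j) ◃ (∣ i ∣ ℕ.* ∣ j ∣) ⟧ℤ            ≈⟨ ◃-homo (sign i Sign.* sign j) (∣ i ∣ ℕ.* ∣ j ∣) ⟩
    ⟦ sign i Sign.* sign j ⟧ₛ * (∣ i ∣ ℕ.* ∣ j ∣) · 1#         ≈⟨ *-cong (sign-homo (sign i) (sign j)) (×1-homo-* ∣ i ∣ ∣ j ∣) ⟩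
    (⟦ sign i ⟧ₛ * ⟦ sign j ⟧ₛ) * (∣ i ∣ · 1# * ∣ j ∣ · 1#)   ≈⟨ *-interchange _ _ _ _ ⟩
    (⟦ sign i ⟧ₛ * ∣ i ∣ · 1#) * (⟦ sign j ⟧ₛ * ∣ j ∣ · 1#)   ≈⟨ *-cong (sign-abs i) (sign-abs j) ⟨
    ⟦ i ⟧ℤ * ⟦ j ⟧ℤ                                             ∎

  homomorphism : ℤ.+-*-rawRing -Raw-AlmostCommutative⟶ fromCommutativeRing R
  homomorphism = record
    { ⟦_⟧    = ⟦_⟧ℤ
    ; +-homo = +-homo
    ; *-homo = *-homo
    ; -‿homo = -‿homo
    ; 0-homo = refl
    ; 1-homo = refl
    }

  -- syntactic equality of coefficients suffices for the normaliser
  coefficient-equality : ∀ i j → Maybe (⟦ i ⟧ℤ ≈ ⟦ j ⟧ℤ)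
  coefficient-equality i j with i ℤ.≟ j
  ... | yes ≡.refl = just refl
  ... | no _       = nothing

  open import Algebra.Solver.Ring ℤ.+-*-rawRing (fromCommutativeRing R) homomorphism coefficient-equality public
    using (solve; _:=_; _:+_; _:*_; :-_; con)

module OrderedFieldProperties {c ℓ} (F : OrderedField c ℓ) where
  open OrderedField F
  open IntegerRingSolver commutativeRing
  open import Algebra.Properties.Ring ring using (-0#≈0#; -‿involutive; -‿distribʳ-*)
  open IsTotalOrder isTotalOrder public
    using (total; antisym) renaming (refl to ≤-refl; trans to ≤-trans; reflexive to ≤-reflexive)

  poset : Poset c ℓ ℓ
  poset = record { isPartialOrder = IsTotalOrder.isPartialOrder isTotalOrder }

  module ≤-Reasoning = Relation.Binary.Reasoning.PartialOrder poset

  +-monoʳ-≤ : ∀ {x y} z → x ≤ y → z + x ≤ z + y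
  +-monoʳ-≤ {x} {y} z x≤y = begin
    z + x   ≈⟨ +-comm z x ⟩
    x + z   ≤⟨ +-monoˡ-≤ z x≤y ⟩
    y + z   ≈⟨ +-comm y z ⟩
    z + y   ∎
    where open ≤-Reasoning

  x≤x+y : ∀ {x y} → 0# ≤ y → x ≤ x + y
  x≤x+y {x} {y} 0≤y = begin
    x        ≈⟨ +-identityʳ x ⟨
    x + 0#   ≤⟨ +-monoʳ-≤ x 0≤y ⟩
    x + y    ∎
    where open ≤-Reasoning

  +-nonneg : ∀ {x y} → 0# ≤ x → 0# ≤ y → 0# ≤ x + y
  +-nonneg {x} 0≤x 0≤y = ≤-trans 0≤x (x≤x+y 0≤y)

  ≤⇒0≤- : ∀ {x y} → x ≤ y → 0# ≤ y - x
  ≤⇒0≤- {x} {y} x≤y = begin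
    0#      ≈⟨ -‿inverseʳ x ⟨
    x - x   ≤⟨ +-monoˡ-≤ (- x) x≤y ⟩
    y - x   ∎
    where open ≤-Reasoning

  0≤-⇒≤ : ∀ {x y} → 0# ≤ y - x → x ≤ y
  0≤-⇒≤ {x} {y} 0≤y-x = begin
    x             ≈⟨ +-identityˡ x ⟨
    0# + x        ≤⟨ +-monoˡ-≤ x 0≤y-x ⟩
    (y - x) + x   ≈⟨ solve 2 (λ x y → (y :+ :- x) :+ x := y) refl x y ⟩
    y             ∎
    where open ≤-Reasoning

  neg-antitone : ∀ {x y} → x ≤ y → - y ≤ - x
  neg-antitone {x} {y} x≤y = 0≤-⇒≤ (begin
    0#         ≤⟨ ≤⇒0≤- x≤y ⟩
    y - x      ≈⟨ solve 2 (λ x y → y :+ :- x := :- x :+ :- (:- y)) refl x y ⟩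
    - x - - y  ∎)
    where open ≤-Reasoning

  nonpos⇒neg-nonneg : ∀ {x} → x ≤ 0# → 0# ≤ - x
  nonpos⇒neg-nonneg x≤0 = ≤-trans (≤-reflexive (sym -0#≈0#)) (neg-antitone x≤0)

  neg-nonneg⇒nonpos : ∀ {x} → 0# ≤ - x → x ≤ 0#
  neg-nonneg⇒nonpos {x} 0≤-x =
    ≤-trans (≤-reflexive (sym (-‿involutive x))) (≤-trans (neg-antitone 0≤-x) (≤-reflexive -0#≈0#))

  square-nonneg : ∀ x → 0# ≤ x * x
  square-nonneg x with total 0# x
  ... | inj₁ 0≤x = *-nonneg 0≤x 0≤x
  ... | inj₂ x≤0 = begin
    0#            ≤⟨ *-nonneg (nonpos⇒neg-nonneg x≤0) (nonpos⇒neg-nonneg x≤0) ⟩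
    - x * - x     ≈⟨ solve 1 (λ x → :- x :* :- x := x :* x) refl x ⟩
    x * x         ∎
    where open ≤-Reasoning

  nonneg-*-nonpos : ∀ {x y} → 0# ≤ x → y ≤ 0# → x * y ≤ 0#
  nonneg-*-nonpos {x} {y} 0≤x y≤0 = neg-nonneg⇒nonpos (begin
    0#          ≤⟨ *-nonneg 0≤x (nonpos⇒neg-nonneg y≤0) ⟩
    x * - y     ≈⟨ -‿distribʳ-* x y ⟨
    - (x * y)   ∎)
    where open ≤-Reasoning

  0≤1 : 0# ≤ 1#
  0≤1 = ≤-trans (square-nonneg 1#) (≤-reflexive (*-identityˡ 1#))

  1≤2 : 1# ≤ 2#
  1≤2 = x≤x+y 0≤1

  -1≤0 : - 1# ≤ 0#
  -1≤0 = ≤-trans (neg-antitone 0≤1) (≤-reflexive -0#≈0#)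

  -1≤1 : - 1# ≤ 1#
  -1≤1 = ≤-trans -1≤0 0≤1

  ≤⇒-≤0 : ∀ {x y} → x ≤ y → x - y ≤ 0#
  ≤⇒-≤0 {x} {y} x≤y = neg-nonneg⇒nonpos (begin
    0#          ≤⟨ ≤⇒0≤- x≤y ⟩
    y - x       ≈⟨ solve 2 (λ x y → y :+ :- x := :- (x :+ :- y)) refl x y ⟩
    - (x - y)   ∎)
    where open ≤-Reasoning

  AbsLe-weaken : ∀ {x y z} → AbsLe x y → y ≤ z → AbsLe x z
  AbsLe-weaken (-y≤x , x≤y) y≤z = ≤-trans (neg-antitone y≤z) -y≤x , ≤-trans x≤y y≤z

  *-cancelˡ-zero : ∀ {x y} → ¬ (x ≈ 0#) → x * y ≈ 0# → y ≈ 0#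
  *-cancelˡ-zero {x} {y} x≉0 xy≈0 = begin
    y                  ≈⟨ *-identityˡ y ⟨
    1# * y             ≈⟨ *-congʳ (trans (*-comm (x ⁻¹) x) (⁻¹-inverseʳ x≉0)) ⟨
    (x ⁻¹ * x) * y     ≈⟨ *-assoc (x ⁻¹) x y ⟩
    x ⁻¹ * (x * y)     ≈⟨ *-congˡ xy≈0 ⟩
    x ⁻¹ * 0#          ≈⟨ zeroʳ (x ⁻¹) ⟩
    0#                 ∎
    where open Relation.Binary.Reasoning.Setoid setoid

  ⁻¹-nonzero : ∀ {t} → ¬ (t ≈ 0#) → ¬ (t ⁻¹ ≈ 0#)
  ⁻¹-nonzero {t} t≉0 t⁻¹≈0 = 0≉1 (trans (sym (trans (*-congˡ t⁻¹≈0) (zeroʳ t))) (⁻¹-inverseʳ t≉0))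

  ⁻¹-nonneg : ∀ {t} → 0# < t → 0# ≤ t ⁻¹
  ⁻¹-nonneg {t} (0≤t , 0≉t) with total 0# (t ⁻¹)
  ... | inj₁ 0≤t⁻¹ = 0≤t⁻¹
  ... | inj₂ t⁻¹≤0 = contradiction (antisym 0≤1 1≤0) 0≉1
    where
    1≤0 : 1# ≤ 0#
    1≤0 = ≤-trans (≤-reflexive (sym (⁻¹-inverseʳ (λ t≈0 → 0≉t (sym t≈0)))))
                  (nonneg-*-nonpos 0≤t t⁻¹≤0)

module Summation {c ℓ} (F : OrderedField c ℓ) where
  open OrderedField F
  open OrderedFieldProperties F
  open IntegerRingSolver commutativeRing
  open import Algebra.Properties.Semiring.Sum semiring
    using (sum; sum-cong-≋; ∑-distrib-+; ∑-comm; sum-init-last; sum-replicate-zero; *-distribˡ-sum)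
  open import Algebra.Properties.Ring ring using (-1*x≈-x)
  open Relation.Binary.Reasoning.Setoid setoid

  ∑≈sum : ∀ n (f : Fin n → Carrier) → ∑ n f ≈ sum f
  ∑≈sum zero    f = refl
  ∑≈sum (suc n) f = +-congˡ (∑≈sum n (λ i → f (suc i)))

  ∑-cong : ∀ n {f g : Fin n → Carrier} → (∀ i → f i ≈ g i) → ∑ n f ≈ ∑ n g
  ∑-cong n {f} {g} f≈g = begin
    ∑ n f     ≈⟨ ∑≈sum n f ⟩
    sum f     ≈⟨ sum-cong-≋ f≈g ⟩
    sum g     ≈⟨ ∑≈sum n g ⟨
    ∑ n g     ∎

  ∑-zero : ∀ n → ∑ n (λ _ → 0#) ≈ 0#
  ∑-zero n = trans (∑≈sum n _) (sum-replicate-zero n)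

  ∑-+ : ∀ n (f g : Fin n → Carrier) → ∑ n (λ i → f i + g i) ≈ ∑ n f + ∑ n g
  ∑-+ n f g = begin
    ∑ n (λ i → f i + g i)     ≈⟨ ∑≈sum n _ ⟩
    sum (λ i → f i + g i)     ≈⟨ ∑-distrib-+ f g ⟩
    sum f + sum g             ≈⟨ +-cong (∑≈sum n f) (∑≈sum n g) ⟨
    ∑ n f + ∑ n g             ∎

  ∑-*ˡ : ∀ n a (f : Fin n → Carrier) → a * ∑ n f ≈ ∑ n (λ i → a * f i)
  ∑-*ˡ n a f = begin
    a * ∑ n f              ≈⟨ *-congˡ (∑≈sum n f) ⟩
    a * sum f              ≈⟨ *-distribˡ-sum a f ⟩
    sum (λ i → a * f i)    ≈⟨ ∑≈sum n _ ⟨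
    ∑ n (λ i → a * f i)    ∎

  ∑-*ʳ : ∀ n a (f : Fin n → Carrier) → ∑ n f * a ≈ ∑ n (λ i → f i * a)
  ∑-*ʳ n a f = trans (*-comm _ a) (trans (∑-*ˡ n a f) (∑-cong n (λ i → *-comm a (f i))))

  ∑-neg : ∀ n (f : Fin n → Carrier) → ∑ n (λ i → - f i) ≈ - ∑ n f
  ∑-neg n f = begin
    ∑ n (λ i → - f i)        ≈⟨ ∑-cong n (λ i → -1*x≈-x (f i)) ⟨
    ∑ n (λ i → - 1# * f i)   ≈⟨ ∑-*ˡ n (- 1#) f ⟨
    - 1# * ∑ n f             ≈⟨ -1*x≈-x _ ⟩
    - ∑ n f                  ∎

  ∑-swap : ∀ m n (f : Fin m → Fin n → Carrier) →
    ∑ m (λ i → ∑ n (λ j → f i j)) ≈ ∑ n (λ j → ∑ m (λ i → f i j))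
  ∑-swap m n f = begin
    ∑ m (λ i → ∑ n (λ j → f i j))     ≈⟨ double m n f ⟩
    sum (λ i → sum (λ j → f i j))     ≈⟨ ∑-comm f ⟩
    sum (λ j → sum (λ i → f i j))     ≈⟨ double n m (λ j i → f i j) ⟨
    ∑ n (λ j → ∑ m (λ i → f i j))     ∎
    where
    double : ∀ m n (g : Fin m → Fin n → Carrier) →
      ∑ m (λ i → ∑ n (g i)) ≈ sum (λ i → sum (g i))
    double m n g = trans (∑≈sum m _) (sum-cong-≋ (λ i → ∑≈sum n (g i)))

  ∑-init-last : ∀ n (f : Fin (suc n) → Carrier) → ∑ (suc n) f ≈ ∑ n (λ i → f (inject₁ i)) + f (fromℕ n)
  ∑-init-last n f = begin
    ∑ (suc n) f                              ≈⟨ ∑≈sum (suc n) f ⟩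
    sum f                                    ≈⟨ sum-init-last f ⟩
    sum (λ i → f (inject₁ i)) + f (fromℕ n)  ≈⟨ +-congʳ (∑≈sum n _) ⟨
    ∑ n (λ i → f (inject₁ i)) + f (fromℕ n)  ∎

  ∑-bilinear : ∀ m n (y : Fin m → Carrier) (P : Fin m → Fin n → Carrier) (w : Fin n → Carrier) →
    ∑ m (λ k → y k * ∑ n (λ e → P k e * w e)) ≈ ∑ n (λ e → ∑ m (λ k → P k e * y k) * w e)
  ∑-bilinear m n y P w = begin
    ∑ m (λ k → y k * ∑ n (λ e → P k e * w e))      ≈⟨ ∑-cong m (λ k → ∑-*ˡ n (y k) _) ⟩
    ∑ m (λ k → ∑ n (λ e → y k * (P k e * w e)))    ≈⟨ ∑-swap m n _ ⟩
    ∑ n (λ e → ∑ m (λ k → y k * (P k e * w e)))    ≈⟨ ∑-cong n (λ e → ∑-cong m (λ k → reorder (y k) (P k e) (w e))) ⟩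
    ∑ n (λ e → ∑ m (λ k → (P k e * y k) * w e))    ≈⟨ ∑-cong n (λ e → ∑-*ʳ m (w e) _) ⟨
    ∑ n (λ e → ∑ m (λ k → P k e * y k) * w e)      ∎
    where
    reorder : ∀ a b c → a * (b * c) ≈ (b * a) * c
    reorder = solve 3 (λ a b c → a :* (b :* c) := (b :* a) :* c) refl

  ∑-nonneg : ∀ n (f : Fin n → Carrier) → (∀ i → 0# ≤ f i) → 0# ≤ ∑ n f
  ∑-nonneg zero    f 0≤f = ≤-refl
  ∑-nonneg (suc n) f 0≤f = +-nonneg (0≤f zero) (∑-nonneg n _ (λ i → 0≤f (suc i)))

  term≤∑ : ∀ n (f : Fin n → Carrier) → (∀ i → 0# ≤ f i) → ∀ i → f i ≤ ∑ n f
  term≤∑ (suc n) f 0≤f zero    = x≤x+y (∑-nonneg n _ (λ i → 0≤f (suc i)))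
  term≤∑ (suc n) f 0≤f (suc i) =
    ≤-trans (term≤∑ n _ (λ k → 0≤f (suc k)) i) (≤-trans (x≤x+y (0≤f zero)) (≤-reflexive (+-comm _ _)))

  ∑-nonneg-zero : ∀ n (f : Fin n → Carrier) → (∀ i → 0# ≤ f i) → ∑ n f ≈ 0# → ∀ i → f i ≈ 0#
  ∑-nonneg-zero n f 0≤f ∑f≈0 i = antisym (≤-trans (term≤∑ n f 0≤f i) (≤-reflexive ∑f≈0)) (0≤f i)

module KroneckerDelta {c ℓ} (F : OrderedField c ℓ) where
  open OrderedField F
  open Summation F

  Id-diag : ∀ {n} {i j : Fin n} → i ≡ j → Id F i j ≈ 1#
  Id-diag {i = i} {j} i≡j with i ≟ j
  ... | yes _   = refl
  ... | no i≢j = contradiction i≡j i≢j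

  Id-offdiag : ∀ {n} {i j : Fin n} → i ≢ j → Id F i j ≈ 0#
  Id-offdiag {i = i} {j} i≢j with i ≟ j
  ... | yes i≡j = contradiction i≡j i≢j
  ... | no _    = refl

  Id-suc : ∀ {n} (i j : Fin n) → Id F (suc i) (suc j) ≈ Id F i j
  Id-suc i j = by-cases (i ≟ j)
    where
    by-cases : Dec (i ≡ j) → Id F (suc i) (suc j) ≈ Id F i j
    by-cases (yes i≡j) = trans (Id-diag (≡.cong suc i≡j)) (sym (Id-diag i≡j))
    by-cases (no i≢j)  = trans (Id-offdiag (i≢j ∘ suc-injective)) (sym (Id-offdiag i≢j))

  Id-sym : ∀ {n} (i j : Fin n) → Id F i j ≈ Id F j i
  Id-sym i j = by-cases (i ≟ j)
    where
    by-cases : Dec (i ≡ j) → Id F i j ≈ Id F j i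
    by-cases (yes i≡j) = trans (Id-diag i≡j) (sym (Id-diag (≡.sym i≡j)))
    by-cases (no i≢j)  = trans (Id-offdiag i≢j) (sym (Id-offdiag (i≢j ∘ ≡.sym)))

  ∑-sift : ∀ n (k₀ : Fin n) (f : Fin n → Carrier) → (∀ k → k ≢ k₀ → f k ≈ 0#) → ∑ n f ≈ f k₀
  ∑-sift (suc n) zero f f≈0 =
    trans (+-congˡ (trans (∑-cong n (λ k → f≈0 (suc k) λ ())) (∑-zero n))) (+-identityʳ _)
  ∑-sift (suc n) (suc k₀) f f≈0 =
    trans (+-cong (f≈0 zero λ ()) (∑-sift n k₀ _ (λ k k≢k₀ → f≈0 (suc k) (k≢k₀ ∘ suc-injective)))) (+-identityˡ _)

  ∑-Id : ∀ n (k₀ : Fin n) (g : Fin n → Carrier) → ∑ n (λ k → Id F k k₀ * g k) ≈ g k₀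
  ∑-Id n k₀ g = trans (∑-sift n k₀ _ (λ k k≢k₀ → trans (*-congʳ (Id-offdiag k≢k₀)) (zeroˡ (g k))))
                      (trans (*-congʳ (Id-diag {i = k₀} ≡.refl)) (*-identityˡ (g k₀)))

-- The
-- inverse is built by induction on the size through the Schur complement
-- of the top-left entry.
module SymmetricInverse {c ℓ} (F : OrderedField c ℓ) where
  open OrderedField F
  open Summation F
  open KroneckerDelta F
  open IntegerRingSolver commutativeRing
  open Relation.Binary.Reasoning.Setoid setoid

  Matrix : ℕ → Set c
  Matrix n = Fin n → Fin n → Carrier

  Symmetric : ∀ {n} → Matrix n → Set ℓ
  Symmetric A = ∀ i j → A i j ≈ A j i

  Q : ∀ n → Matrix n → (Fin n → Carrier) → Carrier
  Q n A x = ∑ n (λ i → x i * ∑ n (λ j → A i j * x j))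

  Anisotropic : ∀ n → Matrix n → Set (c ⊔ ℓ)
  Anisotropic n A = ∀ x → Q n A x ≈ 0# → ¬ ¬ (∀ i → x i ≈ 0#)

  -- the first basis vector shows that the pivot of an anisotropic form is nonzero
  pivot-nonzero : ∀ {m} (A : Matrix (suc m)) → Anisotropic (suc m) A → ¬ (A zero zero ≈ 0#)
  pivot-nonzero {m} A A-aniso a≈0 = A-aniso e₀ Qe₀≈0 (λ e₀≈0 → 0≉1 (sym (e₀≈0 zero)))
    where
    e₀ : Fin (suc m) → Carrier
    e₀ zero    = 1#
    e₀ (suc _) = 0#
    Qe₀≈0 : Q (suc m) A e₀ ≈ 0#
    Qe₀≈0 = begin
      1# * (A zero zero * 1# + ∑ m (λ j → A zero (suc j) * 0#)) + ∑ m (λ i → 0# * _)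
        ≈⟨ +-cong (*-congˡ (+-congˡ (trans (∑-cong m (λ j → zeroʳ _)) (∑-zero m))))
                  (trans (∑-cong m (λ i → zeroˡ _)) (∑-zero m)) ⟩
      1# * (A zero zero * 1# + 0#) + 0#
        ≈⟨ solve 1 (λ a → con (+ 1) :* (a :* con (+ 1) :+ con (+ 0)) :+ con (+ 0) := a) refl (A zero zero) ⟩
      A zero zero
        ≈⟨ a≈0 ⟩
      0# ∎

  symmetric-right-inverse : ∀ {n} (A N : Matrix n) → Symmetric A → Symmetric N →
    (∀ i j → (_⊗_ F A N) i j ≈ Id F i j) → IsInverseMatrix F A N
  symmetric-right-inverse {n} A N A-sym N-sym AN≈Id = AN≈Id , NA≈Id
    where
    NA≈Id : ∀ i j → (_⊗_ F N A) i j ≈ Id F i j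
    NA≈Id i j = begin
      ∑ n (λ k → N i k * A k j)    ≈⟨ ∑-cong n (λ k → trans (*-comm _ _) (*-cong (A-sym k j) (N-sym i k))) ⟩
      ∑ n (λ k → A j k * N k i)    ≈⟨ AN≈Id j i ⟩
      Id F j i                     ≈⟨ Id-sym j i ⟩
      Id F i j                     ∎

  module SchurComplement {m} (A : Matrix (suc m)) (A-sym : Symmetric A) (a≉0 : ¬ (A zero zero ≈ 0#)) where
    a a⁻¹ : Carrier
    a   = A zero zero
    a⁻¹ = a ⁻¹

    a*a⁻¹ : a * a⁻¹ ≈ 1#
    a*a⁻¹ = ⁻¹-inverseʳ a≉0

    b : Fin m → Carrier
    b j = A zero (suc j)

    C S : Matrix m
    C i j = A (suc i) (suc j)
    S i j = C i j - b i * b j * a⁻¹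

    S-sym : Symmetric S
    S-sym i j = +-cong (A-sym (suc i) (suc j)) (-‿cong (*-congʳ (*-comm (b i) (b j))))

    b· : (Fin m → Carrier) → Carrier
    b· z = ∑ m (λ k → b k * z k)

    S-apply : ∀ i (z : Fin m → Carrier) → ∑ m (λ k → S i k * z k) ≈ ∑ m (λ k → C i k * z k) - b i * a⁻¹ * b· z
    S-apply i z = begin
      ∑ m (λ k → S i k * z k)
        ≈⟨ ∑-cong m (λ k → distribute (C i k) (b i) (b k) (z k)) ⟩
      ∑ m (λ k → C i k * z k + - (b i * a⁻¹) * (b k * z k))
        ≈⟨ ∑-+ m _ _ ⟩
      ∑ m (λ k → C i k * z k) + ∑ m (λ k → - (b i * a⁻¹) * (b k * z k))
        ≈⟨ +-congˡ (∑-*ˡ m _ _) ⟨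
      ∑ m (λ k → C i k * z k) + - (b i * a⁻¹) * b· z
        ≈⟨ +-congˡ (solve 2 (λ x y → (:- x) :* y := :- (x :* y)) refl _ _) ⟩
      ∑ m (λ k → C i k * z k) - b i * a⁻¹ * b· z ∎
      where
      distribute : ∀ c x y z → (c - x * y * a⁻¹) * z ≈ c * z + - (x * a⁻¹) * (y * z)
      distribute c x y z =
        solve 5 (λ c x y z ai → (c :+ :- (x :* y :* ai)) :* z := c :* z :+ (:- (x :* ai)) :* (y :* z)) refl c x y z a⁻¹

    C-apply : ∀ i (z : Fin m → Carrier) → ∑ m (λ k → C i k * z k) ≈ ∑ m (λ k → S i k * z k) + b i * a⁻¹ * b· z
    C-apply i z = begin
      ∑ m (λ k → C i k * z k)             ≈⟨ solve 2 (λ x y → x := (x :+ :- y) :+ y) refl _ _ ⟩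
      ∑ m (λ k → C i k * z k) - v + v     ≈⟨ +-congʳ (S-apply i z) ⟨
      ∑ m (λ k → S i k * z k) + v         ∎
      where
      v : Carrier
      v = b i * a⁻¹ * b· z

    form-S : ∀ y → Q m S y ≈ Q m C y - a⁻¹ * b· y * b· y
    form-S y = begin
      ∑ m (λ i → y i * ∑ m (λ j → S i j * y j))
        ≈⟨ ∑-cong m (λ i → *-congˡ (S-apply i y)) ⟩
      ∑ m (λ i → y i * (∑ m (λ j → C i j * y j) - b i * a⁻¹ * b· y))
        ≈⟨ ∑-cong m (λ i → solve 5 (λ y r b ai β → y :* (r :+ :- (b :* ai :* β))
               := y :* r :+ (:- (ai :* β)) :* (b :* y)) refl (y i) _ (b i) a⁻¹ (b· y)) ⟩
      ∑ m (λ i → y i * ∑ m (λ j → C i j * y j) + - (a⁻¹ * b· y) * (b i * y i))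
        ≈⟨ ∑-+ m _ _ ⟩
      Q m C y + ∑ m (λ i → - (a⁻¹ * b· y) * (b i * y i))
        ≈⟨ +-congˡ (∑-*ˡ m _ _) ⟨
      Q m C y + - (a⁻¹ * b· y) * b· y
        ≈⟨ +-congˡ (solve 2 (λ x y → (:- x) :* y := :- (x :* y)) refl _ _) ⟩
      Q m C y - a⁻¹ * b· y * b· y ∎

    form-lower-rows : ∀ x₀ y →
      ∑ m (λ i → y i * (A (suc i) zero * x₀ + ∑ m (λ j → C i j * y j))) ≈ b· y * x₀ + Q m C y
    form-lower-rows x₀ y = begin
      ∑ m (λ i → y i * (A (suc i) zero * x₀ + ∑ m (λ j → C i j * y j)))
        ≈⟨ ∑-cong m (λ i → trans (*-congˡ (+-congʳ (*-congʳ (A-sym (suc i) zero))))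
             (solve 4 (λ y b x r → y :* (b :* x :+ r) := (b :* y) :* x :+ y :* r) refl (y i) (b i) x₀ _)) ⟩
      ∑ m (λ i → (b i * y i) * x₀ + y i * ∑ m (λ j → C i j * y j))
        ≈⟨ ∑-+ m _ _ ⟩
      ∑ m (λ i → (b i * y i) * x₀) + Q m C y
        ≈⟨ +-congʳ (∑-*ʳ m x₀ _) ⟨
      b· y * x₀ + Q m C y ∎

    extend : (Fin m → Carrier) → Fin (suc m) → Carrier
    extend y zero    = - (b· y * a⁻¹)
    extend y (suc j) = y j

    form-extend : ∀ y → Q (suc m) A (extend y) ≈ Q m S y
    form-extend y = begin
      x₀ * (a * x₀ + β) + ∑ m (λ i → y i * (A (suc i) zero * x₀ + ∑ m (λ j → C i j * y j)))
        ≈⟨ +-congˡ (form-lower-rows x₀ y) ⟩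
      x₀ * (a * x₀ + β) + (β * x₀ + Q m C y)
        ≈⟨ solve 4 (λ a ai β q → (:- (β :* ai)) :* (a :* (:- (β :* ai)) :+ β) :+ (β :* (:- (β :* ai)) :+ q)
                 := q :+ (β :* β :* ai) :* (a :* ai) :+ :- (β :* β :* ai) :+ :- (β :* β :* ai)) refl a a⁻¹ β (Q m C y) ⟩
      Q m C y + (β * β * a⁻¹) * (a * a⁻¹) - β * β * a⁻¹ - β * β * a⁻¹
        ≈⟨ +-congʳ (+-congʳ (+-congˡ (trans (*-congˡ a*a⁻¹) (*-identityʳ _)))) ⟩
      Q m C y + β * β * a⁻¹ - β * β * a⁻¹ - β * β * a⁻¹
        ≈⟨ solve 3 (λ ai β q → q :+ β :* β :* ai :+ :- (β :* β :* ai) :+ :- (β :* β :* ai)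
                 := q :+ :- (ai :* β :* β)) refl a⁻¹ β (Q m C y) ⟩
      Q m C y - a⁻¹ * β * β
        ≈⟨ form-S y ⟨
      Q m S y ∎
      where
      β x₀ : Carrier
      β  = b· y
      x₀ = extend y zero

    S-anisotropic : Anisotropic (suc m) A → Anisotropic m S
    S-anisotropic A-aniso y Qy≈0 y≉0 =
      A-aniso (extend y) (trans (form-extend y) Qy≈0) (λ x≈0 → y≉0 (λ j → x≈0 (suc j)))

    module Bordered (N′ : Matrix m) (N′-sym : Symmetric N′)
                    (SN′≈Id : ∀ i j → ∑ m (λ k → S i k * N′ k j) ≈ Id F i j) where
      w : Fin m → Carrier
      w i = ∑ m (λ k → N′ i k * b k)

      bᵀw : Carrier
      bᵀw = b· w

      N : Matrix (suc m)
      N zero    zero    = a⁻¹ + a⁻¹ * a⁻¹ * bᵀw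
      N zero    (suc j) = - (a⁻¹ * w j)
      N (suc i) zero    = - (a⁻¹ * w i)
      N (suc i) (suc j) = N′ i j

      N-sym : Symmetric N
      N-sym zero    zero    = refl
      N-sym zero    (suc j) = refl
      N-sym (suc i) zero    = refl
      N-sym (suc i) (suc j) = N′-sym i j

      bᵀN′≈wᵀ : ∀ j → b· (λ k → N′ k j) ≈ w j
      bᵀN′≈wᵀ j = ∑-cong m (λ k → trans (*-comm _ _) (*-congʳ (N′-sym k j)))

      Sw≈b : ∀ i → ∑ m (λ k → S i k * w k) ≈ b i
      Sw≈b i = begin
        ∑ m (λ k → S i k * ∑ m (λ l → N′ k l * b l))    ≈⟨ ∑-bilinear m m (S i) N′ b ⟩
        ∑ m (λ l → ∑ m (λ k → N′ k l * S i k) * b l)    ≈⟨ ∑-cong m (λ l → *-congʳ (column l)) ⟩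
        ∑ m (λ l → Id F l i * b l)                      ≈⟨ ∑-Id m i b ⟩
        b i                                             ∎
        where
        column : ∀ l → ∑ m (λ k → N′ k l * S i k) ≈ Id F l i
        column l = trans (∑-cong m (λ k → *-comm _ _)) (trans (SN′≈Id i l) (Id-sym i l))

      apply-column : ∀ (z : Fin m → Carrier) → ∑ m (λ k → z k * - (a⁻¹ * w k)) ≈ - a⁻¹ * ∑ m (λ k → z k * w k)
      apply-column z = trans (∑-cong m (λ k → solve 3 (λ z a w → z :* (:- (a :* w)) := (:- a) :* (z :* w)) refl (z k) a⁻¹ (w k)))
                             (sym (∑-*ˡ m _ _))

      AN-top-left : a * N zero zero + ∑ m (λ k → b k * N (suc k) zero) ≈ 1#
      AN-top-left = begin
        a * (a⁻¹ + a⁻¹ * a⁻¹ * bᵀw) + ∑ m (λ k → b k * - (a⁻¹ * w k))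
          ≈⟨ +-congˡ (apply-column b) ⟩
        a * (a⁻¹ + a⁻¹ * a⁻¹ * bᵀw) + - a⁻¹ * bᵀw
          ≈⟨ solve 3 (λ a ai bw → a :* (ai :+ ai :* ai :* bw) :+ (:- ai) :* bw
                := (a :* ai) :+ (a :* ai) :* ai :* bw :+ (:- ai) :* bw) refl a a⁻¹ bᵀw ⟩
        a * a⁻¹ + (a * a⁻¹) * a⁻¹ * bᵀw + - a⁻¹ * bᵀw
          ≈⟨ +-congʳ (+-cong a*a⁻¹ (*-congʳ (*-congʳ a*a⁻¹))) ⟩
        1# + 1# * a⁻¹ * bᵀw + - a⁻¹ * bᵀw
          ≈⟨ solve 2 (λ ai bw → con (+ 1) :+ con (+ 1) :* ai :* bw :+ (:- ai) :* bw := con (+ 1)) refl a⁻¹ bᵀw ⟩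
        1# ∎

      AN-top-right : ∀ j → a * N zero (suc j) + ∑ m (λ k → b k * N (suc k) (suc j)) ≈ 0#
      AN-top-right j = begin
        a * - (a⁻¹ * w j) + ∑ m (λ k → b k * N′ k j)
          ≈⟨ +-congˡ (bᵀN′≈wᵀ j) ⟩
        a * - (a⁻¹ * w j) + w j
          ≈⟨ solve 3 (λ a ai w → a :* (:- (ai :* w)) :+ w := (:- (a :* ai)) :* w :+ w) refl a a⁻¹ (w j) ⟩
        - (a * a⁻¹) * w j + w j
          ≈⟨ +-congʳ (*-congʳ (-‿cong a*a⁻¹)) ⟩
        - 1# * w j + w j
          ≈⟨ solve 1 (λ w → (:- con (+ 1)) :* w :+ w := con (+ 0)) refl (w j) ⟩
        0# ∎

      AN-bottom-left : ∀ i → A (suc i) zero * N zero zero + ∑ m (λ k → C i k * N (suc k) zero) ≈ 0#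
      AN-bottom-left i = begin
        A (suc i) zero * (a⁻¹ + a⁻¹ * a⁻¹ * bᵀw) + ∑ m (λ k → C i k * - (a⁻¹ * w k))
          ≈⟨ +-cong (*-congʳ (A-sym (suc i) zero)) (apply-column (C i)) ⟩
        b i * (a⁻¹ + a⁻¹ * a⁻¹ * bᵀw) + - a⁻¹ * ∑ m (λ k → C i k * w k)
          ≈⟨ +-congˡ (*-congˡ (trans (C-apply i w) (+-congʳ (Sw≈b i)))) ⟩
        b i * (a⁻¹ + a⁻¹ * a⁻¹ * bᵀw) + - a⁻¹ * (b i + b i * a⁻¹ * bᵀw)
          ≈⟨ solve 3 (λ b ai bw → b :* (ai :+ ai :* ai :* bw) :+ (:- ai) :* (b :+ b :* ai :* bw) := con (+ 0)) refl (b i) a⁻¹ bᵀw ⟩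
        0# ∎

      AN-bottom-right : ∀ i j → A (suc i) zero * N zero (suc j) + ∑ m (λ k → C i k * N′ k j) ≈ Id F i j
      AN-bottom-right i j = begin
        A (suc i) zero * - (a⁻¹ * w j) + ∑ m (λ k → C i k * N′ k j)
          ≈⟨ +-cong (*-congʳ (A-sym (suc i) zero)) (C-apply i (λ k → N′ k j)) ⟩
        b i * - (a⁻¹ * w j) + (∑ m (λ k → S i k * N′ k j) + b i * a⁻¹ * b· (λ k → N′ k j))
          ≈⟨ +-congˡ (+-cong (SN′≈Id i j) (*-congˡ (bᵀN′≈wᵀ j))) ⟩
        b i * - (a⁻¹ * w j) + (Id F i j + b i * a⁻¹ * w j)
          ≈⟨ solve 4 (λ b ai w d → b :* (:- (ai :* w)) :+ (d :+ b :* ai :* w) := d) refl (b i) a⁻¹ (w j) (Id F i j) ⟩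
        Id F i j ∎

      AN≈Id : ∀ i j → (_⊗_ F A N) i j ≈ Id F i j
      AN≈Id zero    zero    = trans AN-top-left (sym (Id-diag {i = zero {m}} ≡.refl))
      AN≈Id zero    (suc j) = trans (AN-top-right j) (sym (Id-offdiag {i = zero} {suc j} λ ()))
      AN≈Id (suc i) zero    = trans (AN-bottom-left i) (sym (Id-offdiag {i = suc i} {zero} λ ()))
      AN≈Id (suc i) (suc j) = trans (AN-bottom-right i j) (sym (Id-suc i j))

  symmetric-inverse : ∀ n (A : Matrix n) → Symmetric A → Anisotropic n A →
    Σ (Matrix n) λ N → IsInverseMatrix F A N × Symmetric N
  symmetric-inverse zero    A A-sym A-aniso = (λ ()) , ((λ ()) , (λ ())) , (λ ())
  symmetric-inverse (suc m) A A-sym A-aniso = N , symmetric-right-inverse A N A-sym N-sym AN≈Id , N-sym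
    where
    open SchurComplement A A-sym (pivot-nonzero A A-aniso)
    S-inverse : Σ (Matrix m) λ N′ → IsInverseMatrix F S N′ × Symmetric N′
    S-inverse = symmetric-inverse m S S-sym (S-anisotropic A-aniso)
    open Bordered (proj₁ S-inverse) (proj₂ (proj₂ S-inverse)) (proj₁ (proj₁ (proj₂ S-inverse)))

-- The indicator of the left alternative of a decision, and the basic fact
-- behind cuts at a threshold θ: a flow c·(x_h − x_t) with c ≥ 0 along an
-- edge crosses the level θ only downwards, from potential ≥ θ to below.
module Thresholds {c ℓ} (F : OrderedField c ℓ) where
  open OrderedField F
  open OrderedFieldProperties F
  open IntegerRingSolver commutativeRing

  indicator : ∀ {A B : Set ℓ} → A ⊎ B → Carrier
  indicator (inj₁ _) = 1#
  indicator (inj₂ _) = 0#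

  indicator-difference≤1 : ∀ {A B C D : Set ℓ} (s : A ⊎ B) (s′ : C ⊎ D) → indicator s - indicator s′ ≤ 1#
  indicator-difference≤1 (inj₁ _) (inj₁ _) = ≤-trans (≤-reflexive (-‿inverseʳ 1#)) 0≤1
  indicator-difference≤1 (inj₁ _) (inj₂ _) = ≤-reflexive (solve 0 (con (+ 1) :+ :- con (+ 0) := con (+ 1)) refl)
  indicator-difference≤1 (inj₂ _) (inj₁ _) = ≤-trans (≤-reflexive (+-identityˡ _)) -1≤1
  indicator-difference≤1 (inj₂ _) (inj₂ _) = ≤-trans (≤-reflexive (-‿inverseʳ 0#)) 0≤1

  threshold-crossing-nonneg : ∀ {θ xₕ xₜ c} → 0# ≤ c →
    (sₕ : (θ ≤ xₕ) ⊎ (xₕ ≤ θ)) (sₜ : (θ ≤ xₜ) ⊎ (xₜ ≤ θ)) →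
    0# ≤ (indicator sₕ - indicator sₜ) * (c * (xₕ - xₜ))
  threshold-crossing-nonneg {θ} {xₕ} {xₜ} {c} 0≤c = crossing
    where
    open ≤-Reasoning
    crossing : (sₕ : (θ ≤ xₕ) ⊎ (xₕ ≤ θ)) (sₜ : (θ ≤ xₜ) ⊎ (xₜ ≤ θ)) →
      0# ≤ (indicator sₕ - indicator sₜ) * (c * (xₕ - xₜ))
    crossing (inj₁ _) (inj₁ _) = ≤-reflexive (solve 3 (λ c h t → con (+ 0) := (con (+ 1) :+ :- con (+ 1)) :* (c :* (h :+ :- t))) refl c xₕ xₜ)
    crossing (inj₂ _) (inj₂ _) = ≤-reflexive (solve 3 (λ c h t → con (+ 0) := (con (+ 0) :+ :- con (+ 0)) :* (c :* (h :+ :- t))) refl c xₕ xₜ)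
    crossing (inj₁ θ≤xₕ) (inj₂ xₜ≤θ) = begin
      0#                                   ≤⟨ *-nonneg 0≤c (≤⇒0≤- (≤-trans xₜ≤θ θ≤xₕ)) ⟩
      c * (xₕ - xₜ)                        ≈⟨ solve 3 (λ c h t → c :* (h :+ :- t) := (con (+ 1) :+ :- con (+ 0)) :* (c :* (h :+ :- t))) refl c xₕ xₜ ⟩
      (1# - 0#) * (c * (xₕ - xₜ))          ∎
    crossing (inj₂ xₕ≤θ) (inj₁ θ≤xₜ) = begin
      0#                                   ≤⟨ *-nonneg 0≤c (≤⇒0≤- (≤-trans xₕ≤θ θ≤xₜ)) ⟩
      c * (xₜ - xₕ)                        ≈⟨ solve 3 (λ c h t → c :* (t :+ :- h) := (con (+ 0) :+ :- con (+ 1)) :* (c :* (h :+ :- t))) refl c xₕ xₜ ⟩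
      (0# - 1#) * (c * (xₕ - xₜ))          ∎

snoc : ∀ {a} {A : Set a} {m} → (Fin m → A) → A → Fin (suc m) → A
snoc {m = zero}  x z _       = z
snoc {m = suc m} x z zero    = x zero
snoc {m = suc m} x z (suc k) = snoc (x ∘ suc) z k

snoc-inject₁ : ∀ {a} {A : Set a} {m} (x : Fin m → A) z i → snoc x z (inject₁ i) ≡ x i
snoc-inject₁ {m = suc m} x z zero    = ≡.refl
snoc-inject₁ {m = suc m} x z (suc i) = snoc-inject₁ (x ∘ suc) z i

snoc-last : ∀ {a} {A : Set a} {m} (x : Fin m → A) z → snoc x z (fromℕ m) ≡ z
snoc-last {m = zero}  x z = ≡.refl
snoc-last {m = suc m} x z = snoc-last (x ∘ suc) z

¬¬-all : ∀ {p} m {P : Fin m → Set p} → (∀ i → ¬ ¬ P i) → ¬ ¬ (∀ i → P i)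
¬¬-all zero    ¬¬P ¬all = ¬all (λ ())
¬¬-all (suc m) ¬¬P ¬all = ¬¬P zero (λ P₀ → ¬¬-all m (¬¬P ∘ suc) (λ Pₛ → ¬all (λ { zero → P₀ ; (suc i) → Pₛ i })))

module Network {c ℓ} (F : OrderedField c ℓ) {n E : ℕ} (Γ : DiGraph (suc n) E) (no-loops : NoSelfLoops Γ)
               (v : Fin (suc n) ↔ Fin (suc n)) (t : Fin E → OrderedField.Carrier F) (t-pos : ∀ e → OrderedField._<_ F (OrderedField.0# F) (t e))
  where
  open OrderedField F
  open OrderedFieldProperties F
  open Summation F
  open KroneckerDelta F
  open SymmetricInverse F using (Matrix; Symmetric; Q; Anisotropic)
  open Thresholds F
  open IntegerRingSolver commutativeRing
  open import Algebra.Properties.Ring ring using (-0#≈0#; x∙y⁻¹≈ε⇒x≈y)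
  open Relation.Binary.Reasoning.Setoid setoid
  open Inverse v using (to; from; strictlyInverseˡ; strictlyInverseʳ)

  hd tl : Fin E → Fin (suc n)
  hd e = from (DiGraph.head Γ e)
  tl e = from (DiGraph.tail Γ e)

  incidence : Fin (suc n) → Fin E → Carrier
  incidence k e = ρ F Γ (to k) e

  conductance : Fin E → Carrier
  conductance e = t e ⁻¹

  conductance-nonneg : ∀ e → 0# ≤ conductance e
  conductance-nonneg e = ⁻¹-nonneg (t-pos e)

  conductance-nonzero : ∀ e → ¬ (conductance e ≈ 0#)
  conductance-nonzero e = ⁻¹-nonzero (λ t≈0 → proj₂ (t-pos e) (sym t≈0))

  located : ∀ {k w} → w ≡ to k → k ≡ from w
  located {k} w≡k = ≡.sym (≡.trans (≡.cong from w≡k) (strictlyInverseʳ k))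

  elsewhere : ∀ {k w} → w ≢ to k → k ≢ from w
  elsewhere {w = w} w≢k k≡w = w≢k (≡.sym (≡.trans (≡.cong to k≡w) (strictlyInverseˡ w)))

  incidence-δ : ∀ k e → incidence k e ≈ Id F k (hd e) - Id F k (tl e)
  incidence-δ k e with DiGraph.head Γ e ≟ to k
  ... | yes h≡k = sym (begin
    Id F k (hd e) - Id F k (tl e)    ≈⟨ +-cong (Id-diag (located h≡k)) (-‿cong (Id-offdiag tail-elsewhere)) ⟩
    1# - 0#                          ≈⟨ trans (+-congˡ -0#≈0#) (+-identityʳ 1#) ⟩
    1#                               ∎)
    where
    tail-elsewhere : k ≢ tl e
    tail-elsewhere k≡t = no-loops e (≡.trans h≡k (≡.trans (≡.cong to k≡t) (strictlyInverseˡ _)))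
  ... | no h≢k with DiGraph.tail Γ e ≟ to k
  ...   | yes t≡k = sym (begin
    Id F k (hd e) - Id F k (tl e)    ≈⟨ +-cong (Id-offdiag (elsewhere h≢k)) (-‿cong (Id-diag (located t≡k))) ⟩
    0# - 1#                          ≈⟨ +-identityˡ _ ⟩
    - 1#                             ∎)
  ...   | no t≢k = sym (begin
    Id F k (hd e) - Id F k (tl e)    ≈⟨ +-cong (Id-offdiag (elsewhere h≢k)) (-‿cong (Id-offdiag (elsewhere t≢k))) ⟩
    0# - 0#                          ≈⟨ -‿inverseʳ 0# ⟩
    0#                               ∎)

  coboundary : ∀ e (g : Fin (suc n) → Carrier) → ∑ (suc n) (λ k → incidence k e * g k) ≈ g (hd e) - g (tl e)
  coboundary e g = begin
    ∑ (suc n) (λ k → incidence k e * g k)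
      ≈⟨ ∑-cong (suc n) (λ k → trans (*-congʳ (incidence-δ k e)) (split (Id F k (hd e)) (Id F k (tl e)) (g k))) ⟩
    ∑ (suc n) (λ k → Id F k (hd e) * g k + - (Id F k (tl e) * g k))
      ≈⟨ ∑-+ (suc n) (λ k → Id F k (hd e) * g k) (λ k → - (Id F k (tl e) * g k)) ⟩
    ∑ (suc n) (λ k → Id F k (hd e) * g k) + ∑ (suc n) (λ k → - (Id F k (tl e) * g k))
      ≈⟨ +-cong (∑-Id (suc n) (hd e) g) (trans (∑-neg (suc n) (λ k → Id F k (tl e) * g k)) (-‿cong (∑-Id (suc n) (tl e) g))) ⟩
    g (hd e) - g (tl e) ∎
    where
    split : ∀ p q x → (p - q) * x ≈ p * x + - (q * x)
    split = solve 3 (λ p q x → (p :+ :- q) :* x := p :* x :+ :- (q :* x)) refl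

  potential : (Fin n → Carrier) → Fin (suc n) → Carrier
  potential x = snoc x 0#

  drop : (Fin n → Carrier) → Fin E → Carrier
  drop x e = ∑ n (λ i → incidence (inject₁ i) e * x i)

  drop-potential : ∀ x e → drop x e ≈ potential x (hd e) - potential x (tl e)
  drop-potential x e = begin
    drop x e
      ≈⟨ +-identityʳ _ ⟨
    drop x e + 0#
      ≈⟨ +-cong (∑-cong n (λ i → *-congˡ (reflexive (≡.sym (snoc-inject₁ x 0# i)))))
                (sym (trans (*-congˡ (reflexive (snoc-last x 0#))) (zeroʳ _))) ⟩
    ∑ n (λ i → incidence (inject₁ i) e * potential x (inject₁ i)) + incidence (fromℕ n) e * potential x (fromℕ n)
      ≈⟨ ∑-init-last n (λ k → incidence k e * potential x k) ⟨
    ∑ (suc n) (λ k → incidence k e * potential x k)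
      ≈⟨ coboundary e (potential x) ⟩
    potential x (hd e) - potential x (tl e) ∎

  Laplacian : Matrix n
  Laplacian = M F Γ v t

  Laplacian-sym : Symmetric Laplacian
  Laplacian-sym i j = ∑-cong E (λ e → solve 3 (λ p c q → p :* (c :* q) := q :* (c :* p)) refl _ _ _)

  Laplacian-apply : ∀ x i →
    ∑ n (λ l → Laplacian i l * x l) ≈ ∑ E (λ e → incidence (inject₁ i) e * (conductance e * drop x e))
  Laplacian-apply x i = begin
    ∑ n (λ l → Laplacian i l * x l)
      ≈⟨ ∑-cong n (λ l → ∑-*ʳ E (x l) _) ⟩
    ∑ n (λ l → ∑ E (λ e → ρᵢ e * (conductance e * ρₗ l e) * x l))
      ≈⟨ ∑-swap n E _ ⟩
    ∑ E (λ e → ∑ n (λ l → ρᵢ e * (conductance e * ρₗ l e) * x l))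
      ≈⟨ ∑-cong E (λ e → ∑-cong n (λ l → regroup (ρᵢ e) (conductance e) (ρₗ l e) (x l))) ⟩
    ∑ E (λ e → ∑ n (λ l → (ρᵢ e * conductance e) * (ρₗ l e * x l)))
      ≈⟨ ∑-cong E (λ e → trans (sym (∑-*ˡ n _ _)) (*-assoc _ _ _)) ⟩
    ∑ E (λ e → ρᵢ e * (conductance e * drop x e)) ∎
    where
    ρᵢ : Fin E → Carrier
    ρᵢ = incidence (inject₁ i)
    ρₗ : Fin n → Fin E → Carrier
    ρₗ l = incidence (inject₁ l)
    regroup : ∀ p c q y → p * (c * q) * y ≈ (p * c) * (q * y)
    regroup = solve 4 (λ p c q y → p :* (c :* q) :* y := (p :* c) :* (q :* y)) refl

  energy : ∀ x → Q n Laplacian x ≈ ∑ E (λ e → drop x e * (conductance e * drop x e))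
  energy x = begin
    ∑ n (λ i → x i * ∑ n (λ l → Laplacian i l * x l))
      ≈⟨ ∑-cong n (λ i → *-congˡ (Laplacian-apply x i)) ⟩
    ∑ n (λ i → x i * ∑ E (λ e → incidence (inject₁ i) e * (conductance e * drop x e)))
      ≈⟨ ∑-bilinear n E x (λ i → incidence (inject₁ i)) (λ e → conductance e * drop x e) ⟩
    ∑ E (λ e → drop x e * (conductance e * drop x e)) ∎

  energy-zero⇒no-drop : ∀ x → Q n Laplacian x ≈ 0# → ∀ e → ¬ ¬ (drop x e ≈ 0#)
  energy-zero⇒no-drop x Q≈0 e drop≉0 =
    drop≉0 (*-cancelˡ-zero (conductance-nonzero e) (*-cancelˡ-zero drop≉0 (term≈0 e)))
    where
    term-nonneg : ∀ e → 0# ≤ drop x e * (conductance e * drop x e)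
    term-nonneg e = ≤-trans (*-nonneg (conductance-nonneg e) (square-nonneg (drop x e)))
                            (≤-reflexive (solve 2 (λ c d → c :* (d :* d) := d :* (c :* d)) refl (conductance e) (drop x e)))
    term≈0 : ∀ e → drop x e * (conductance e * drop x e) ≈ 0#
    term≈0 = ∑-nonneg-zero E _ term-nonneg (trans (sym (energy x)) Q≈0)

  -- on a connected graph, potentials without drops are constant, hence equal
  -- to the grounded potential 0
  no-drop⇒zero : Connected Γ → ∀ x → (∀ e → drop x e ≈ 0#) → ∀ i → x i ≈ 0#
  no-drop⇒zero connected x no-drop i = begin
    x i                         ≡⟨ snoc-inject₁ x 0# i ⟨
    potential x (inject₁ i)     ≡⟨ ≡.cong (potential x) (strictlyInverseʳ (inject₁ i)) ⟨
    Y (to (inject₁ i))          ≈⟨ along (connected (to (inject₁ i)) (to (fromℕ n))) ⟩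
    Y (to (fromℕ n))            ≡⟨ ≡.cong (potential x) (strictlyInverseʳ (fromℕ n)) ⟩
    potential x (fromℕ n)       ≡⟨ snoc-last x 0# ⟩
    0#                          ∎
    where
    Y : Fin (suc n) → Carrier
    Y w = potential x (from w)
    level : ∀ e → Y (DiGraph.head Γ e) ≈ Y (DiGraph.tail Γ e)
    level e = x∙y⁻¹≈ε⇒x≈y _ _ (trans (sym (drop-potential x e)) (no-drop e))
    along : ∀ {u w} → Walk Γ u w → Y u ≈ Y w
    along []          = refl
    along (fwd e walk) = trans (sym (level e)) (along walk)
    along (bwd e walk) = trans (level e) (along walk)

  Laplacian-anisotropic : Connected Γ → Anisotropic n Laplacian
  Laplacian-anisotropic connected x Q≈0 x≉0 =
    ¬¬-all E (energy-zero⇒no-drop x Q≈0) (λ no-drop → x≉0 (no-drop⇒zero connected x no-drop))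

  -- Column j of a right inverse N of M: the potentials when a unit current
  -- is injected at vertex j and extracted at the ground.
  module UnitCurrent (N : Matrix n) (MN≈Id : ∀ i k → (_⊗_ F Laplacian N) i k ≈ Id F i k) (j : Fin n) where
    X : Fin (suc n) → Carrier
    X = potential (λ i → N i j)

    current : Fin E → Carrier
    current e = conductance e * (X (hd e) - X (tl e))

    outflow : Fin (suc n) → Carrier
    outflow k = ∑ E (λ e → incidence k e * current e)

    outflow-inner : ∀ i → outflow (inject₁ i) ≈ Id F i j
    outflow-inner i = begin
      ∑ E (λ e → incidence (inject₁ i) e * current e)
        ≈⟨ ∑-cong E (λ e → *-congˡ (*-congˡ (drop-potential (λ l → N l j) e))) ⟨
      ∑ E (λ e → incidence (inject₁ i) e * (conductance e * drop (λ l → N l j) e))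
        ≈⟨ Laplacian-apply (λ l → N l j) i ⟨
      ∑ n (λ l → Laplacian i l * N l j)
        ≈⟨ MN≈Id i j ⟩
      Id F i j ∎

    -- every edge current leaves one vertex and enters another
    outflow-total : ∑ (suc n) outflow ≈ 0#
    outflow-total = begin
      ∑ (suc n) (λ k → ∑ E (λ e → incidence k e * current e))   ≈⟨ ∑-swap (suc n) E (λ k e → incidence k e * current e) ⟩
      ∑ E (λ e → ∑ (suc n) (λ k → incidence k e * current e))   ≈⟨ ∑-cong E (λ e → trans (coboundary e (λ _ → current e)) (-‿inverseʳ (current e))) ⟩
      ∑ E (λ e → 0#)                                            ≈⟨ ∑-zero E ⟩
      0#                                                        ∎

    outflow-ground : outflow (fromℕ n) ≈ - 1#
    outflow-ground = begin
      outflow (fromℕ n)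
        ≈⟨ solve 2 (λ s g → g := s :+ g :+ :- s) refl _ _ ⟩
      (∑ n (λ i → outflow (inject₁ i)) + outflow (fromℕ n)) - ∑ n (λ i → outflow (inject₁ i))
        ≈⟨ +-cong (trans (sym (∑-init-last n outflow)) outflow-total) (-‿cong (trans (∑-cong n outflow-inner) Id-column-sum)) ⟩
      0# - 1#
        ≈⟨ +-identityˡ _ ⟩
      - 1# ∎
      where
      Id-column-sum : ∑ n (λ i → Id F i j) ≈ 1#
      Id-column-sum = trans (∑-cong n (λ i → sym (*-identityʳ _))) (∑-Id n j (λ _ → 1#))

    flux : ∀ (σ : Fin (suc n) → Carrier) → ∑ (suc n) (λ k → σ k * outflow k) ≈ ∑ E (λ e → (σ (hd e) - σ (tl e)) * current e)
    flux σ = begin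
      ∑ (suc n) (λ k → σ k * ∑ E (λ e → incidence k e * current e))    ≈⟨ ∑-bilinear (suc n) E σ incidence current ⟩
      ∑ E (λ e → ∑ (suc n) (λ k → incidence k e * σ k) * current e)    ≈⟨ ∑-cong E (λ e → *-congʳ (coboundary e σ)) ⟩
      ∑ E (λ e → (σ (hd e) - σ (tl e)) * current e)                    ∎

    net-flux : ∀ (σ : Fin (suc n) → Carrier) → ∑ (suc n) (λ k → σ k * outflow k) ≈ σ (inject₁ j) - σ (fromℕ n)
    net-flux σ = begin
      ∑ (suc n) (λ k → σ k * outflow k)
        ≈⟨ ∑-init-last n (λ k → σ k * outflow k) ⟩
      ∑ n (λ i → σ (inject₁ i) * outflow (inject₁ i)) + σ (fromℕ n) * outflow (fromℕ n)
        ≈⟨ +-cong (∑-cong n (λ i → trans (*-congˡ (outflow-inner i)) (*-comm _ _))) (*-congˡ outflow-ground) ⟩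
      ∑ n (λ i → Id F i j * σ (inject₁ i)) + σ (fromℕ n) * - 1#
        ≈⟨ +-cong (∑-Id n j (λ i → σ (inject₁ i))) (solve 1 (λ x → x :* (:- con (+ 1)) := :- x) refl _) ⟩
      σ (inject₁ j) - σ (fromℕ n) ∎

    module Cut (a : Fin (suc n)) where
      side : ∀ k → (X a ≤ X k) ⊎ (X k ≤ X a)
      side k with k ≟ a
      ... | yes k≡a = inj₁ (≤-reflexive (reflexive (≡.cong X (≡.sym k≡a))))
      ... | no _    = total (X a) (X k)

      σ : Fin (suc n) → Carrier
      σ k = indicator (side k)

      σ-threshold : σ a ≈ 1#
      σ-threshold with a ≟ a
      ... | yes _   = refl
      ... | no a≢a = contradiction ≡.refl a≢a

      crossing : Fin E → Carrier
      crossing e = (σ (hd e) - σ (tl e)) * current e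

      crossing-nonneg : ∀ e → 0# ≤ crossing e
      crossing-nonneg e = threshold-crossing-nonneg (conductance-nonneg e) (side (hd e)) (side (tl e))

      crossing≤1 : ∀ e → crossing e ≤ 1#
      crossing≤1 e =
        ≤-trans (term≤∑ E crossing crossing-nonneg e)                      -- crossing e ≤ ∑ₑ crossing e
          (≤-trans (≤-reflexive (trans (sym (flux σ)) (net-flux σ)))      --   = σ j − σ ground
                   (indicator-difference≤1 (side (inject₁ j)) (side (fromℕ n))))  --   ≤ 1

    -- cut at the head of e: either the tail lies below it and the crossing
    -- is the current itself, or the current flows uphill and is ≤ 0
    current≤1 : ∀ e → current e ≤ 1#
    current≤1 e = bound (side (tl e)) (≤-trans (≤-reflexive (*-congʳ (+-congʳ (sym σ-threshold)))) (crossing≤1 e))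
      where
      open Cut (hd e)
      bound : (s : (X (hd e) ≤ X (tl e)) ⊎ (X (tl e) ≤ X (hd e))) → (1# - indicator s) * current e ≤ 1# → current e ≤ 1#
      bound (inj₂ _)     crossing≤1 =
        ≤-trans (≤-reflexive (solve 1 (λ z → z := (con (+ 1) :+ :- con (+ 0)) :* z) refl (current e))) crossing≤1
      bound (inj₁ Xₕ≤Xₜ) _          = ≤-trans (nonneg-*-nonpos (conductance-nonneg e) (≤⇒-≤0 Xₕ≤Xₜ)) 0≤1

    -- symmetrically, cut at the tail of e
    -1≤current : ∀ e → - 1# ≤ current e
    -1≤current e = bound (side (hd e)) (≤-trans (≤-reflexive (*-congʳ (+-congˡ (-‿cong (sym σ-threshold))))) (crossing≤1 e))
      where
      open Cut (tl e)
      bound : (s : (X (tl e) ≤ X (hd e)) ⊎ (X (hd e) ≤ X (tl e))) → (indicator s - 1#) * current e ≤ 1# → - 1# ≤ current e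
      bound (inj₂ _)     crossing≤1 =
        ≤-trans (neg-antitone crossing≤1) (≤-reflexive (solve 1 (λ z → :- ((con (+ 0) :+ :- con (+ 1)) :* z) := z) refl (current e)))
      bound (inj₁ Xₜ≤Xₕ) _          = ≤-trans -1≤0 (*-nonneg (conductance-nonneg e) (≤⇒0≤- Xₜ≤Xₕ))

    -- the quantity of the theorem is the current through e
    current-bound : ∀ e → AbsLe (drop (λ i → N i j) e * conductance e) 2#
    current-bound e = AbsLe-weaken (≤-trans (-1≤current e) (≤-reflexive (sym is-current)) ,
                                    ≤-trans (≤-reflexive is-current) (current≤1 e)) 1≤2
      where
      is-current : drop (λ i → N i j) e * conductance e ≈ current e
      is-current = trans (*-comm _ _) (*-congˡ (drop-potential (λ i → N i j) e))

mainTheorem6 : ∀ {c ℓ} (F : OrderedField c ℓ) → let open OrderedField F in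
    (n E : ℕ) → 2 ≤ℕ suc n → (Γ : DiGraph (suc n) E) →
    Connected Γ → NoSelfLoops Γ →
    (v : Fin (suc n) ↔ Fin (suc n)) →
    (t : Fin E → Carrier) → (∀ e → 0# < t e) →
    Σ (Fin n → Fin n → Carrier) λ N →
      IsInverseMatrix F (M F Γ v t) N ×
      (∀ (e : Fin E) (j : Fin n) →
        AbsLe (∑ n (λ i → ρ F Γ (Inverse.to v (inject₁ i)) e * N i j) * t e ⁻¹) 2#)
mainTheorem6 F n E _ Γ connected no-loops v t t-pos = N , N-inverse , unit-current-bound
  where
  open OrderedField F using (AbsLe; 2#; _*_)
  open Network F Γ no-loops v t t-pos
  open SymmetricInverse F using (Matrix; Symmetric; symmetric-inverse)

  M-inverse : Σ (Matrix n) λ N → IsInverseMatrix F Laplacian N × Symmetric N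
  M-inverse = symmetric-inverse n Laplacian Laplacian-sym (Laplacian-anisotropic connected)

  N : Matrix n
  N = proj₁ M-inverse

  N-inverse : IsInverseMatrix F Laplacian N
  N-inverse = proj₁ (proj₂ M-inverse)

  unit-current-bound : ∀ e j → AbsLe (drop (λ i → N i j) e * conductance e) 2#
  unit-current-bound e j = UnitCurrent.current-bound N (proj₁ N-inverse) j e
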